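{- Let $G$ be a singleton-partition graph of order $n$ with $\delta(G)=1$ that contains no full vertex. Then the $G$-SC chain is one of the following chains, where $H_1$ denotes some graph in the family $\mathcal{H}_1$: (a) $G\to H_1$; (b) $G\to C_4\to K_4\to\overline{K}_4$; (c) $G\to K_{2,n-2}\to K_1+K_{1,n-2}$.
   Context: All graphs are finite and simple. A full vertex is a vertex adjacent to all other vertices. A set $D\subseteq V$ is dominating if every vertex not in $D$ has a neighbor in $D$. Two disjoint sets $A,B\subseteq V$ form a coalition if neither is dominating but $A\cup B$ is. A coalition partition of $G$ is a partition $\mathcal{P}$ of $V$ such that every member is either a dominating set of cardinality 1, or is not dominating and forms a coalition with some other member. The coalition graph ${\rm CG}(G,\mathcal{P})$ has vertex set $\mathcal{P}$, two members adjacent iff they form a coalition. $\Gamma_1$ is the partition of $V$ into singletons; $G$ is a singleton-partition graph (SP-graph) if $\Gamma_1$ is a coalition partition of $G$. A singleton coalition graph chain with initial graph $G_1$ is a sequence $G_1\to G_2\to\cdots$ where each graph having a successor is an SP-graph and its successor is ${\rm CG}(G_i,\Gamma_1)$ (up to isomorphism). The $G$-SC chain is such a chain starting at $G$ of maximum possible length (it continues as long as the current graph is an SP-graph). $+$ denotes the join of graphs, $\overline{K}_m$ the edgeless graph on $m$ vertices. The family $\mathcal{H}_1$: all bipartite graphs with parts $A_1=\{x_1,y_1\}$ and $B_1=P_1\cup\{w_1\}\cup Q_1$, where $|P_1\cup Q_1|\ge1$ and if $Q_1\neq\emptyset$ then $|Q_1|\ge 2$; $y_1$ is adjacent to every vertex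 of $B_1$, and $x_1$ is adjacent exactly to the vertices of $P_1\cup\{w_1\}$; there are no other edges. -}

module Defs where

open import Data.Nat using (ℕ; zero; suc; _≤_; _<ᵇ_)
open import Data.Bool using (Bool; true; false; not; _∧_; _∨_; _xor_)
open import Data.Bool.Properties using (xor-same; ∧-comm; ∨-comm)
open import Data.Fin using (Fin; toℕ; _≟_)
open import Data.Fin.Subset using (Subset; ⁅_⁆; _∪_; _∈_; _∉_; ∣_∣)
open import Data.Product using (Σ; ∃; ∃-syntax; _×_; _,_)
open import Data.Sum using (_⊎_)
open import Data.Empty using (⊥)
open import Relation.Nullary using (¬_; does)
open import Relation.Binary.PropositionalEquality using (_≡_; _≢_; refl; cong; cong₂; sym)
open import Function.Bundles using (_⇔_)
open import Function.Definitions using (Bijective)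

record Graph (n : ℕ) : Set where
  field
    E      : Fin n → Fin n → Bool
    E-sym  : ∀ i j → E i j ≡ E j i
    E-irr  : ∀ i → E i i ≡ false
open Graph public

module _ {n : ℕ} (G : Graph n) where

  Adj : Fin n → Fin n → Set
  Adj u v = E G u v ≡ true

  deg : Fin n → ℕ
  deg v = ∣ Data.Vec.tabulate (E G v) ∣
    where import Data.Vec

  MinDegreeOne : Set
  MinDegreeOne = (∀ v → 1 ≤ deg v) × (∃[ v ] deg v ≡ 1)

  Full : Fin n → Set
  Full v = ∀ u → u ≢ v → Adj v u

  Dominating : Subset n → Set
  Dominating D = ∀ v → v ∉ D → ∃[ u ] (u ∈ D × Adj u v)

  Disjoint : Subset n → Subset n → Set
  Disjoint A B = ∀ v → v ∈ A → v ∉ B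

  Coalition : Subset n → Subset n → Set
  Coalition A B = Disjoint A B × ¬ Dominating A × ¬ Dominating B × Dominating (A ∪ B)

  -- Γ₁ (partition into singletons) is a coalition partition:
  -- every member {v} is a dominating set of cardinality 1, or is not
  -- dominating and forms a coalition with some other member {w}.
  IsSP : Set
  IsSP = ∀ v → Dominating ⁅ v ⁆
               ⊎ (¬ Dominating ⁅ v ⁆ × ∃[ w ] (w ≢ v × Coalition ⁅ v ⁆ ⁅ w ⁆))

-- H is (isomorphic to) the coalition graph CG(G, Γ₁); vertex {i} of the
-- coalition graph is identified with i.
IsSingletonCG : {n m : ℕ} → Graph n → Graph m → Set
IsSingletonCG {n} {m} G H =
  ∃[ f ] (Bijective {A = Fin n} {B = Fin m} _≡_ _≡_ f
          × (∀ i j → (Adj H (f i) (f j) ⇔ Coalition G ⁅ i ⁆ ⁅ j ⁆)))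

Step : {n m : ℕ} → Graph n → Graph m → Set
Step G H = IsSP G × IsSingletonCG G H

-- the chain stops at H (H has no successor)
Ends : {n : ℕ} → Graph n → Set
Ends H = ¬ IsSP H

-- The family ℋ₁ (membership up to isomorphism = labelling-free description)
-- A₁ = {x, y}, B₁ = everything else = P ∪ {w} ∪ Q.
-- y ~ every vertex of B₁; x ~ exactly P ∪ {w} = B₁ ∖ Q; no other edges.

_==_ : {n : ℕ} → Fin n → Fin n → Bool
i == j = does (i ≟ j)

H1Edge : {m : ℕ} (x y : Fin m) (Q : Subset m) → Fin m → Fin m → Set
H1Edge x y Q u v =
    (u ≡ y × v ≢ y × v ≢ x)
  ⊎ (v ≡ y × u ≢ y × u ≢ x)
  ⊎ (u ≡ x × v ≢ x × v ≢ y × v ∉ Q)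
  ⊎ (v ≡ x × u ≢ x × u ≢ y × u ∉ Q)

InH1 : {m : ℕ} → Graph m → Set
InH1 {m} H =
  ∃[ x ] ∃[ y ] ∃[ w ] ∃[ Q ]
    ( x ≢ y × w ≢ x × w ≢ y
    × x ∉ Q × y ∉ Q × w ∉ Q
    × 4 ≤ m                                   -- |P₁ ∪ Q₁| ≥ 1
    × (∣ Q ∣ ≡ 0 ⊎ 2 ≤ ∣ Q ∣)
    × (∀ u v → (Adj H u v ⇔ H1Edge x y Q u v)))

private
  xor-comm : ∀ a b → a xor b ≡ b xor a
  xor-comm false false = refl
  xor-comm false true  = refl
  xor-comm true  false = refl
  xor-comm true  true  = refl

  ==-sym : {n : ℕ} (i j : Fin n) → i == j ≡ j == i
  ==-sym i j with i ≟ j | j ≟ i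
  ... | Relation.Nullary.yes _ | Relation.Nullary.yes _ = refl
  ... | Relation.Nullary.no _  | Relation.Nullary.no _  = refl
  ... | Relation.Nullary.yes p | Relation.Nullary.no q  = Data.Empty.⊥-elim (q (sym p))
    where import Data.Empty
  ... | Relation.Nullary.no p  | Relation.Nullary.yes q = Data.Empty.⊥-elim (p (sym q))
    where import Data.Empty

  ==-refl : {n : ℕ} (i : Fin n) → i == i ≡ true
  ==-refl i with i ≟ i
  ... | Relation.Nullary.yes _ = refl
  ... | Relation.Nullary.no p  = Data.Empty.⊥-elim (p refl)
    where import Data.Empty

  small : {n : ℕ} → Fin n → Bool
  small i = toℕ i <ᵇ 2

  odd : ℕ → Bool
  odd zero    = false
  odd (suc k) = not (odd k)

-- complete bipartite graph K_{2,n-2}: parts {0,1} and {2,…,n-1}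
K2,n-2 : (n : ℕ) → Graph n
K2,n-2 n = record
  { E     = λ i j → small i xor small j
  ; E-sym = λ i j → xor-comm (small i) (small j)
  ; E-irr = λ i → xor-same (small i) }

-- K₁ + K_{1,n-2}: vertex 0 is the K₁, vertex 1 is the star centre,
-- vertices 2,…,n-1 are the leaves
K1+K1,n-2 : (n : ℕ) → Graph n
K1+K1,n-2 n = record
  { E     = λ i j → not (i == j) ∧ (small i ∨ small j)
  ; E-sym = λ i j → cong₂ (λ a b → not a ∧ b) (==-sym i j) (∨-comm (small i) (small j))
  ; E-irr = λ i → cong (λ a → not a ∧ (small i ∨ small i)) (==-refl i) }

-- the 4-cycle 0-1-2-3-0
C4 : Graph 4
C4 = record
  { E     = λ i j → odd (toℕ i) xor odd (toℕ j)
  ; E-sym = λ i j → xor-comm (odd (toℕ i)) (odd (toℕ j))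
  ; E-irr = λ i → xor-same (odd (toℕ i)) }

K4 : Graph 4
K4 = record
  { E     = λ i j → not (i == j)
  ; E-sym = λ i j → cong not (==-sym i j)
  ; E-irr = λ i → cong not (==-refl i) }

K̄4 : Graph 4
K̄4 = record
  { E     = λ _ _ → false
  ; E-sym = λ _ _ → refl
  ; E-irr = λ _ → refl }

module Submission where

-- Let v be a leaf of G with neighbour u. As G has no full vertex, {a} and {b} form a coalition
-- exactly when a ≢ b and {a, b} dominates, and every dominating pair contains u or v since it
-- must dominate v. The pair {u, v} is not dominating (u has a non-neighbour), while {u, z} is
-- dominating for every other z: z has a partner, which is u or v, and a partner v can be traded
-- for u because N(v) = {u}. So in CG(G, Γ₁) the vertex u is adjacent to all but v, v is adjacent
-- to the z with {v, z} dominating, and there are no other edges: CG(G, Γ₁) lies in ℋ₁ with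
-- x₁ = v, y₁ = u, and Q₁ the vertices z ≠ u, v with {v, z} not dominating. A vertex of Q₁ leaves
-- some z undominated together with v, and z is again in Q₁, so |Q₁| ≠ 1. If |Q₁| ≥ 2, a vertex of
-- Q₁ has no coalition partner in CG(G, Γ₁) and the chain stops. If Q₁ = ∅, CG(G, Γ₁) is K₂,ₙ₋₂,
-- which continues as C₄ → K₄ → K̄₄ when n = 4, and when n ≥ 5 as K₁ + K₁,ₙ₋₂, in which a vertex of
-- degree two has no coalition partner.

open import Defs
open import Data.Bool using (Bool; true; false; _xor_)
import Data.Bool as Bool
open import Data.Bool.Properties using (¬-not)
open import Data.Empty using (⊥; ⊥-elim)
open import Data.Fin using (Fin; zero; suc; toℕ; _≟_)
open import Data.Fin.Patterns using (0F; 1F; 2F; 3F; 4F)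
open import Data.Fin.Permutation using (Permutation′; _⟨$⟩ʳ_; transpose; _∘ₚ_) renaming (id to idₚ)
import Data.Fin.Permutation.Components as PC
open import Data.Fin.Properties using (all?; any?; ¬∀⟶∃¬)
open import Data.Fin.Subset using (Subset; ⁅_⁆; _∪_; _-_; _∈_; _∉_; ∣_∣; ⊤; Nonempty; Empty)
open import Data.Fin.Subset.Properties
  using (x∈⁅x⁆; x∈⁅y⁆⇒x≡y; x∈p∪q⁻; x∈p∪q⁺; ∪-comm; ∈⊤; ∣⊤∣≡n; ∣⊥∣≡0; Empty-unique; nonempty?;
         x∈p⇒∣p-x∣<∣p∣; x∈p∧x≢y⇒x∈p-y)
open import Data.Nat using (ℕ; zero; suc; _+_; _≤_; _<_; z≤n; s≤s; _<ᵇ_)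
open import Data.Nat.Properties using (≤-<-trans; ≤-reflexive; <-irrefl; _<?_)
open import Data.Product using (Σ; ∃-syntax; _×_; _,_; proj₁; proj₂)
open import Data.Sum using (_⊎_; inj₁; inj₂; [_,_]′)
open import Data.Vec using (tabulate)
open import Data.Vec.Properties using (lookup∘tabulate; []=⇒lookup; lookup⇒[]=)
open import Function using (_∘_)
import Function
open import Function.Bundles using (_⇔_; mk⇔; Equivalence; Bijection)
import Function.Construct.Composition as Composition
import Function.Construct.Identity as Identity
open import Function.Definitions using (Bijective)
import Function.Properties.Equivalence as ⇔
open import Function.Properties.Inverse using (↔⇒⤖)
open import Level using (0ℓ)
open import Relation.Binary.PropositionalEquality using (_≡_; _≢_; refl; sym; trans; subst; cong; cong₂)
open import Relation.Nullary using (¬_; Dec; does; yes; no; ¬?; _×-dec_; _⊎-dec_; _→-dec_)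
open import Relation.Nullary.Decidable
  using (dec-true; dec-false; does-⇔; map′; from-yes; from-no; decidable-stable)
open import Relation.Unary using (Pred; Decidable)

open Equivalence using (to; from)

private
  variable
    n m : ℕ

does≡true⇔ : ∀ {A : Set} (a? : Dec A) → does a? ≡ true ⇔ A
does≡true⇔ (yes a) = mk⇔ (λ _ → a) (λ _ → refl)
does≡true⇔ (no ¬a) = mk⇔ (λ ()) (⊥-elim ∘ ¬a)

∈-tabulate : (f : Fin n → Bool) {x : Fin n} → x ∈ tabulate f ⇔ f x ≡ true
∈-tabulate f {x} = mk⇔ (λ x∈ → trans (sym (lookup∘tabulate f x)) ([]=⇒lookup x∈))
                       (λ fx → lookup⇒[]= x _ (trans (lookup∘tabulate f x) fx))

subset : {P : Pred (Fin n) 0ℓ} → Decidable P → Subset n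
subset P? = tabulate (does ∘ P?)

∈-subset : {P : Pred (Fin n) 0ℓ} (P? : Decidable P) {x : Fin n} → x ∈ subset P? ⇔ P x
∈-subset P? {x} = ⇔.trans (∈-tabulate _) (does≡true⇔ (P? x))

∈⇒<∣p∣ : ∀ {k x} {p : Subset n} → x ∈ p → k ≤ ∣ p - x ∣ → k < ∣ p ∣
∈⇒<∣p∣ x∈p k≤ = ≤-<-trans k≤ (x∈p⇒∣p-x∣<∣p∣ x∈p)

1≤∣p∣⇒nonempty : {p : Subset n} → 1 ≤ ∣ p ∣ → Nonempty p
1≤∣p∣⇒nonempty {n} {p} 1≤∣p∣ with nonempty? p
... | yes ne = ne
... | no empty with () ← subst (1 ≤_) (trans (cong ∣_∣ (Empty-unique empty)) (∣⊥∣≡0 n)) 1≤∣p∣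

distinct-members⇒2≤∣p∣ : ∀ {x y} {p : Subset n} → x ∈ p → y ∈ p → x ≢ y → 2 ≤ ∣ p ∣
distinct-members⇒2≤∣p∣ x∈p y∈p x≢y = ∈⇒<∣p∣ x∈p (∈⇒<∣p∣ (x∈p∧x≢y⇒x∈p-y y∈p (x≢y ∘ sym)) z≤n)

∣p∣≡1⇒unique-member : {p : Subset n} → ∣ p ∣ ≡ 1 → ∃[ x ] (x ∈ p × ∀ y → y ∈ p → y ≡ x)
∣p∣≡1⇒unique-member {p = p} ∣p∣≡1
  with x , x∈p ← 1≤∣p∣⇒nonempty (≤-reflexive (sym ∣p∣≡1))
  = x , x∈p , unique
  where
  unique : ∀ y → y ∈ p → y ≡ x
  unique y y∈p with y ≟ x
  ... | yes y≡x = y≡x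
  ... | no y≢x = ⊥-elim (<-irrefl refl (subst (1 <_) ∣p∣≡1 (distinct-members⇒2≤∣p∣ x∈p y∈p (y≢x ∘ sym))))

distinct⇒4≤n : (a b c d : Fin n) → b ≢ a → c ≢ a → c ≢ b → d ≢ a → d ≢ b → d ≢ c → 4 ≤ n
distinct⇒4≤n {n} a b c d b≢a c≢a c≢b d≢a d≢b d≢c =
  subst (4 ≤_) (∣⊤∣≡n n) (∈⇒<∣p∣ {x = a} ∈⊤ (∈⇒<∣p∣ {x = b} b∈ (∈⇒<∣p∣ {x = c} c∈ (∈⇒<∣p∣ {x = d} d∈ z≤n))))
  where
  b∈ : b ∈ ⊤ - a
  b∈ = x∈p∧x≢y⇒x∈p-y ∈⊤ b≢a
  c∈ : c ∈ ⊤ - a - b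
  c∈ = x∈p∧x≢y⇒x∈p-y (x∈p∧x≢y⇒x∈p-y ∈⊤ c≢a) c≢b
  d∈ : d ∈ ⊤ - a - b - c
  d∈ = x∈p∧x≢y⇒x∈p-y (x∈p∧x≢y⇒x∈p-y (x∈p∧x≢y⇒x∈p-y ∈⊤ d≢a) d≢b) d≢c

permutation-bijective : (π : Permutation′ n) → Bijective _≡_ _≡_ (π ⟨$⟩ʳ_)
permutation-bijective π = Bijection.bijective (↔⇒⤖ π)

transpose-matchˡ : (i j : Fin n) → PC.transpose i j i ≡ j
transpose-matchˡ i j rewrite dec-true (i ≟ i) refl = refl

transpose-fix : ∀ {i j k : Fin n} → k ≢ i → k ≢ j → PC.transpose i j k ≡ k
transpose-fix {i = i} {j} {k} k≢i k≢j rewrite dec-false (k ≟ i) k≢i | dec-false (k ≟ j) k≢j = refl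

permutation-injective : (π : Permutation′ n) {a b : Fin n} → π ⟨$⟩ʳ a ≡ π ⟨$⟩ʳ b → a ≡ b
permutation-injective π = proj₁ (permutation-bijective π)

move-to-0,1 : ∀ {k} {x y : Fin (2 + k)} → x ≢ y →
              ∃[ π ] (π ⟨$⟩ʳ x ≡ 0F × π ⟨$⟩ʳ y ≡ 1F)
move-to-0,1 {x = x} {y} x≢y = transpose x 0F ∘ₚ transpose y′ 1F , x↦0 , transpose-matchˡ y′ 1F
  where
  y′ = PC.transpose x 0F y
  y′≢0 : y′ ≢ 0F
  y′≢0 y′≡0 = x≢y (sym (permutation-injective (transpose x 0F) (trans y′≡0 (sym (transpose-matchˡ x 0F)))))
  x↦0 : PC.transpose y′ 1F (PC.transpose x 0F x) ≡ 0F
  x↦0 rewrite transpose-matchˡ x 0F = transpose-fix (y′≢0 ∘ sym) (λ ())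

<2⇔0F⊎1F : ∀ {k} {i : Fin (2 + k)} → toℕ i < 2 ⇔ (i ≡ 0F ⊎ i ≡ 1F)
<2⇔0F⊎1F = mk⇔ ⇒ λ { (inj₁ refl) → s≤s z≤n ; (inj₂ refl) → s≤s (s≤s z≤n) }
  where
  ⇒ : ∀ {i} → toℕ i < 2 → i ≡ 0F ⊎ i ≡ 1F
  ⇒ {zero}        _ = inj₁ refl
  ⇒ {suc zero}    _ = inj₂ refl
  ⇒ {suc (suc _)} (s≤s (s≤s ()))

-- Domination and singleton coalitions

module _ (G : Graph n) where

  adj? : ∀ a b → Dec (Adj G a b)
  adj? a b = E G a b Bool.≟ true

  adj-sym : ∀ {a b} → Adj G a b → Adj G b a
  adj-sym {a} {b} = trans (E-sym G b a)

  adj⇒≢ : ∀ {a b} → Adj G a b → a ≢ b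
  adj⇒≢ {a} a~a refl with trans (sym a~a) (E-irr G a)
  ... | ()

  Dominates₂ : Fin n → Fin n → Set
  Dominates₂ a b = ∀ z → z ≢ a → z ≢ b → Adj G a z ⊎ Adj G b z

  dominates₂-sym : ∀ {a b} → Dominates₂ a b → Dominates₂ b a
  dominates₂-sym d z z≢b z≢a = [ inj₂ , inj₁ ]′ (d z z≢a z≢b)

  full? : ∀ a → Dec (Full G a)
  full? a = all? λ z → ¬? (z ≟ a) →-dec adj? a z

  dominates₂? : ∀ a b → Dec (Dominates₂ a b)
  dominates₂? a b = all? λ z → ¬? (z ≟ a) →-dec (¬? (z ≟ b) →-dec (adj? a z ⊎-dec adj? b z))

  ¬full⇒non-neighbour : ∀ {a} → ¬ Full G a → ∃[ z ] (z ≢ a × ¬ Adj G a z)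
  ¬full⇒non-neighbour {a} ¬full
    with z , ¬adj ← ¬∀⟶∃¬ n _ (λ z → ¬? (z ≟ a) →-dec adj? a z) ¬full
    = z , (λ z≡a → ¬adj (λ z≢a → ⊥-elim (z≢a z≡a))) , (λ a~z → ¬adj (λ _ → a~z))

  ¬dominates₂⇒undominated : ∀ {a b} → ¬ Dominates₂ a b →
    ∃[ z ] (z ≢ a × z ≢ b × ¬ Adj G a z × ¬ Adj G b z)
  ¬dominates₂⇒undominated {a} {b} ¬dom
    with z , ¬cov ← ¬∀⟶∃¬ n _ (λ z → ¬? (z ≟ a) →-dec (¬? (z ≟ b) →-dec (adj? a z ⊎-dec adj? b z))) ¬dom
    = z , (λ z≡a → ¬cov λ z≢a → ⊥-elim (z≢a z≡a)) , (λ z≡b → ¬cov λ _ z≢b → ⊥-elim (z≢b z≡b))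
        , (λ a~z → ¬cov λ _ _ → inj₁ a~z) , (λ b~z → ¬cov λ _ _ → inj₂ b~z)

  dominating-⁅⁆⇔full : ∀ {a} → Dominating G ⁅ a ⁆ ⇔ Full G a
  dominating-⁅⁆⇔full {a} = mk⇔ ⇒ ⇐
    where
    ⇒ : Dominating G ⁅ a ⁆ → Full G a
    ⇒ dom z z≢a with x , x∈ , x~z ← dom z (z≢a ∘ x∈⁅y⁆⇒x≡y a)
      = subst (λ y → Adj G y z) (x∈⁅y⁆⇒x≡y a x∈) x~z
    ⇐ : Full G a → Dominating G ⁅ a ⁆
    ⇐ full z z∉ = a , x∈⁅x⁆ a , full z (λ z≡a → z∉ (subst (_∈ ⁅ a ⁆) (sym z≡a) (x∈⁅x⁆ a)))

  dominating-pair⇔dominates₂ : ∀ {a b} → Dominating G (⁅ a ⁆ ∪ ⁅ b ⁆) ⇔ Dominates₂ a b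
  dominating-pair⇔dominates₂ {a} {b} = mk⇔ ⇒ ⇐
    where
    ∈pair : ∀ {z} → z ∈ ⁅ a ⁆ ∪ ⁅ b ⁆ → z ≡ a ⊎ z ≡ b
    ∈pair z∈ with x∈p∪q⁻ ⁅ a ⁆ ⁅ b ⁆ z∈
    ... | inj₁ z∈a = inj₁ (x∈⁅y⁆⇒x≡y a z∈a)
    ... | inj₂ z∈b = inj₂ (x∈⁅y⁆⇒x≡y b z∈b)
    ⇒ : Dominating G (⁅ a ⁆ ∪ ⁅ b ⁆) → Dominates₂ a b
    ⇒ dom z z≢a z≢b with x , x∈ , x~z ← dom z ([ z≢a , z≢b ]′ ∘ ∈pair)
      with ∈pair x∈
    ... | inj₁ refl = inj₁ x~z
    ... | inj₂ refl = inj₂ x~z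
    ⇐ : Dominates₂ a b → Dominating G (⁅ a ⁆ ∪ ⁅ b ⁆)
    ⇐ dom z z∉ with dom z (λ { refl → z∉ (x∈p∪q⁺ (inj₁ (x∈⁅x⁆ z))) })
                          (λ { refl → z∉ (x∈p∪q⁺ (inj₂ (x∈⁅x⁆ z))) })
    ... | inj₁ a~z = a , x∈p∪q⁺ (inj₁ (x∈⁅x⁆ a)) , a~z
    ... | inj₂ b~z = b , x∈p∪q⁺ (inj₂ (x∈⁅x⁆ b)) , b~z

  coalition-sym : ∀ {A B} → Coalition G A B → Coalition G B A
  coalition-sym {A} {B} (disj , ¬domA , ¬domB , dom) =
    (λ v v∈B v∈A → disj v v∈A v∈B) , ¬domB , ¬domA , subst (Dominating G) (∪-comm A B) dom

  coalition-⁅⁆⇔ : ∀ {a b} → Coalition G ⁅ a ⁆ ⁅ b ⁆ ⇔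
                  (a ≢ b × ¬ Full G a × ¬ Full G b × Dominates₂ a b)
  coalition-⁅⁆⇔ {a} {b} = mk⇔
    (λ (disj , ¬domA , ¬domB , dom) →
        (λ { refl → disj a (x∈⁅x⁆ a) (x∈⁅x⁆ a) })
      , ¬domA ∘ from dominating-⁅⁆⇔full , ¬domB ∘ from dominating-⁅⁆⇔full
      , to dominating-pair⇔dominates₂ dom)
    (λ (a≢b , ¬fullA , ¬fullB , dom) →
        (λ z z∈a z∈b → a≢b (trans (sym (x∈⁅y⁆⇒x≡y a z∈a)) (x∈⁅y⁆⇒x≡y b z∈b)))
      , ¬fullA ∘ to dominating-⁅⁆⇔full , ¬fullB ∘ to dominating-⁅⁆⇔full
      , from dominating-pair⇔dominates₂ dom)

  coalition? : ∀ a b → Dec (Coalition G ⁅ a ⁆ ⁅ b ⁆)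
  coalition? a b = map′ (from coalition-⁅⁆⇔) (to coalition-⁅⁆⇔)
    (¬? (a ≟ b) ×-dec ¬? (full? a) ×-dec ¬? (full? b) ×-dec dominates₂? a b)

  isSP? : Dec (IsSP G)
  isSP? = all? λ v → dominating? v ⊎-dec (¬? (dominating? v) ×-dec any? λ w → ¬? (w ≟ v) ×-dec coalition? v w)
    where
    dominating? : ∀ v → Dec (Dominating G ⁅ v ⁆)
    dominating? v = map′ (from dominating-⁅⁆⇔full) (to dominating-⁅⁆⇔full) (full? v)

  coalitionGraph : Graph n
  coalitionGraph = record
    { E     = λ a b → does (coalition? a b)
    ; E-sym = λ a b → does-⇔ (mk⇔ coalition-sym coalition-sym) (coalition? a b) (coalition? b a)
    ; E-irr = λ a → dec-false (coalition? a a) λ c → proj₁ (to coalition-⁅⁆⇔ c) refl }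

module _ (G : Graph n) (no-full : ∀ a → ¬ Full G a) where

  coalition⇔dominates₂ : ∀ {a b} → Coalition G ⁅ a ⁆ ⁅ b ⁆ ⇔ (a ≢ b × Dominates₂ G a b)
  coalition⇔dominates₂ {a} {b} = mk⇔
    (λ c → let a≢b , _ , _ , dom = to (coalition-⁅⁆⇔ G) c in a≢b , dom)
    (λ (a≢b , dom) → from (coalition-⁅⁆⇔ G) (a≢b , no-full a , no-full b , dom))

  isSP⇔partners : IsSP G ⇔ (∀ a → ∃[ b ] (a ≢ b × Dominates₂ G a b))
  isSP⇔partners = mk⇔ partner λ partners a → let b , a≢b , dom = partners a in
    inj₂ (no-full a ∘ to (dominating-⁅⁆⇔full G) , b , a≢b ∘ sym , from coalition⇔dominates₂ (a≢b , dom))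
    where
    partner : IsSP G → ∀ a → ∃[ b ] (a ≢ b × Dominates₂ G a b)
    partner sp a with sp a
    ... | inj₁ dom = ⊥-elim (no-full a (to (dominating-⁅⁆⇔full G) dom))
    ... | inj₂ (_ , b , _ , c) = b , to coalition⇔dominates₂ c

isSingletonCG-coalitionGraph : (G : Graph n) → IsSingletonCG G (coalitionGraph G)
isSingletonCG-coalitionGraph G = Function.id , Identity.bijective _≡_ , λ a b → does≡true⇔ (coalition? G a b)

record _≅_ (G : Graph n) (H : Graph m) : Set where
  constructor mk≅
  field
    to-vertex : Fin n → Fin m
    bijective : Bijective _≡_ _≡_ to-vertex
    adj⇔      : ∀ a b → Adj G a b ⇔ Adj H (to-vertex a) (to-vertex b)

isSingletonCG-≅ : ∀ {k} {G : Graph n} {H : Graph m} {H′ : Graph k} →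
                  IsSingletonCG G H → H ≅ H′ → IsSingletonCG G H′
isSingletonCG-≅ (f , f-bij , f-adj) (mk≅ g g-bij g-adj) =
  g ∘ f , Composition.bijective _≡_ _≡_ _≡_ f-bij g-bij ,
  λ a b → ⇔.trans (⇔.sym (g-adj (f a) (f b))) (f-adj a b)

≅-trans : ∀ {k} {G : Graph n} {H : Graph m} {H′ : Graph k} → G ≅ H → H ≅ H′ → G ≅ H′
≅-trans (mk≅ f f-bij f-adj) (mk≅ g g-bij g-adj) =
  mk≅ (g ∘ f) (Composition.bijective _≡_ _≡_ _≡_ f-bij g-bij)
  λ a b → ⇔.trans (f-adj a b) (g-adj (f a) (f b))

step : (G : Graph n) (H : Graph m) → IsSP G → coalitionGraph G ≅ H → Step G H
step G H sp CG≅H = sp , isSingletonCG-≅ {G = G} (isSingletonCG-coalitionGraph G) CG≅H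

≅-by-edges : (G H : Graph n) (π : Permutation′ n) →
             (∀ a b → E G a b ≡ E H (π ⟨$⟩ʳ a) (π ⟨$⟩ʳ b)) → G ≅ H
≅-by-edges G H π same =
  mk≅ (π ⟨$⟩ʳ_) (permutation-bijective π) λ a b → mk⇔ (trans (sym (same a b))) (trans (same a b))

edges-agree? : (G H : Graph n) (π : Permutation′ n) → Dec (∀ a b → E G a b ≡ E H (π ⟨$⟩ʳ a) (π ⟨$⟩ʳ b))
edges-agree? G H π = all? λ a → all? λ b → E G a b Bool.≟ E H (π ⟨$⟩ʳ a) (π ⟨$⟩ʳ b)

-- The chains starting at K₂,ₙ₋₂

K2,2≅C4 : K2,n-2 4 ≅ C4
K2,2≅C4 = ≅-by-edges (K2,n-2 4) C4 π (from-yes (edges-agree? (K2,n-2 4) C4 π))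
  where π = transpose 1F 2F

coalitionGraph-C4≅K4 : coalitionGraph C4 ≅ K4
coalitionGraph-C4≅K4 = ≅-by-edges (coalitionGraph C4) K4 idₚ (from-yes (edges-agree? (coalitionGraph C4) K4 idₚ))

coalitionGraph-K4≅K̄4 : coalitionGraph K4 ≅ K̄4
coalitionGraph-K4≅K̄4 = ≅-by-edges (coalitionGraph K4) K̄4 idₚ (from-yes (edges-agree? (coalitionGraph K4) K̄4 idₚ))

C4→K4→K̄4 : Step C4 K4 × Step K4 K̄4 × Ends K̄4
C4→K4→K̄4 = step C4 K4 (from-yes (isSP? C4)) coalitionGraph-C4≅K4
          , step K4 K̄4 (from-yes (isSP? K4)) coalitionGraph-K4≅K̄4
          , from-no (isSP? K̄4)

module K2,n-2-large (k : ℕ) where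

  private
    N : ℕ
    N = 5 + k

    K L : Graph N
    K = K2,n-2 N
    L = K1+K1,n-2 N

    small : Fin N → Bool
    small i = toℕ i <ᵇ 2

  small⇒0F⊎1F : ∀ {i} → small i ≡ true → i ≡ 0F ⊎ i ≡ 1F
  small⇒0F⊎1F {zero}        _ = inj₁ refl
  small⇒0F⊎1F {suc zero}    _ = inj₂ refl
  small⇒0F⊎1F {suc (suc _)} ()

  ¬three-small : ∀ {a b c} → small a ≡ true → small b ≡ true → small c ≡ true →
                 a ≢ b → a ≢ c → b ≢ c → ⊥
  ¬three-small {a} {b} {c} sa sb sc with small⇒0F⊎1F {a} sa | small⇒0F⊎1F {b} sb | small⇒0F⊎1F {c} sc
  ... | inj₁ refl | inj₁ refl | _         = λ a≢b _ _ → a≢b refl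
  ... | inj₂ refl | inj₂ refl | _         = λ a≢b _ _ → a≢b refl
  ... | inj₁ refl | _         | inj₁ refl = λ _ a≢c _ → a≢c refl
  ... | inj₂ refl | _         | inj₂ refl = λ _ a≢c _ → a≢c refl
  ... | _         | inj₁ refl | inj₁ refl = λ _ _ b≢c → b≢c refl
  ... | _         | inj₂ refl | inj₂ refl = λ _ _ b≢c → b≢c refl

  large-avoiding : ∀ a b → ∃[ z ] (small z ≡ false × z ≢ a × z ≢ b)
  large-avoiding a b with 2F ≟ a | 2F ≟ b | 3F ≟ a | 3F ≟ b
  ... | no 2≢a     | no 2≢b     | _          | _          = 2F , refl , 2≢a , 2≢b
  ... | _          | _          | no 3≢a     | no 3≢b     = 3F , refl , 3≢a , 3≢b
  ... | yes refl   | _          | yes ()     | _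
  ... | _          | yes refl   | _          | yes ()
  ... | yes refl   | _          | _          | yes refl   = 4F , refl , (λ ()) , (λ ())
  ... | _          | yes refl   | yes refl   | _          = 4F , refl , (λ ()) , (λ ())

  K-adj⇔ : ∀ a b → Adj K a b ⇔ (small a ≢ small b)
  K-adj⇔ a b with small a | small b
  ... | true  | true  = mk⇔ (λ ()) (λ ne → ⊥-elim (ne refl))
  ... | true  | false = mk⇔ (λ _ ()) (λ _ → refl)
  ... | false | true  = mk⇔ (λ _ ()) (λ _ → refl)
  ... | false | false = mk⇔ (λ ()) (λ ne → ⊥-elim (ne refl))

  L-adj⇔ : ∀ a b → Adj L a b ⇔ (a ≢ b × (small a ≡ true ⊎ small b ≡ true))
  L-adj⇔ a b with a ≟ b
  ... | yes refl = mk⇔ (λ ()) (λ (a≢a , _) → ⊥-elim (a≢a refl))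
  ... | no a≢b with small a | small b
  ...   | true  | _     = mk⇔ (λ _ → a≢b , inj₁ refl) (λ _ → refl)
  ...   | false | true  = mk⇔ (λ _ → a≢b , inj₂ refl) (λ _ → refl)
  ...   | false | false = mk⇔ (λ ()) (λ { (_ , inj₁ ()) ; (_ , inj₂ ()) })

  no-full-K : ∀ a → ¬ Full K a
  no-full-K zero          full with () ← full 1F (λ ())
  no-full-K (suc zero)    full with () ← full 0F (λ ())
  no-full-K a@(suc (suc _)) full with z , z-large , z≢a , _ ← large-avoiding a a =
    to (K-adj⇔ a z) (full z z≢a) (sym z-large)

  dominates₂-K⇔ : ∀ {a b} → a ≢ b → Dominates₂ K a b ⇔ (small a ≡ true ⊎ small b ≡ true)
  dominates₂-K⇔ {a} {b} a≢b = mk⇔ ⇒ ⇐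
    where
    ⇒ : Dominates₂ K a b → small a ≡ true ⊎ small b ≡ true
    ⇒ dom with small a Bool.≟ true | small b Bool.≟ true
    ... | yes sa | _      = inj₁ sa
    ... | no _   | yes sb = inj₂ sb
    ... | no ¬sa | no ¬sb with z , z-large , z≢a , z≢b ← large-avoiding a b
      with dom z z≢a z≢b
    ... | inj₁ a~z = ⊥-elim (to (K-adj⇔ a z) a~z (trans (¬-not ¬sa) (sym z-large)))
    ... | inj₂ b~z = ⊥-elim (to (K-adj⇔ b z) b~z (trans (¬-not ¬sb) (sym z-large)))
    from-small : ∀ {a b} → a ≢ b → small a ≡ true → Dominates₂ K a b
    from-small {a} {b} a≢b sa z z≢a z≢b with small z Bool.≟ true | small b Bool.≟ true
    ... | no ¬sz | _      = inj₁ (from (K-adj⇔ a z) λ eq → ¬sz (trans (sym eq) sa))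
    ... | yes sz | no ¬sb = inj₂ (from (K-adj⇔ b z) λ eq → ¬sb (trans eq sz))
    ... | yes sz | yes sb = ⊥-elim (¬three-small sa sb sz a≢b (z≢a ∘ sym) (z≢b ∘ sym))
    ⇐ : small a ≡ true ⊎ small b ≡ true → Dominates₂ K a b
    ⇐ (inj₁ sa) = from-small a≢b sa
    ⇐ (inj₂ sb) = dominates₂-sym K (from-small (a≢b ∘ sym) sb)

  isSP-K : IsSP K
  isSP-K = from (isSP⇔partners K no-full-K) partner
    where
    partner : ∀ a → ∃[ b ] (a ≢ b × Dominates₂ K a b)
    partner zero    = 1F , (λ ()) , from (dominates₂-K⇔ λ ()) (inj₁ refl)
    partner (suc a) = 0F , (λ ()) , from (dominates₂-K⇔ λ ()) (inj₂ refl)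

  coalition-K⇔adj-L : ∀ a b → Coalition K ⁅ a ⁆ ⁅ b ⁆ ⇔ Adj L a b
  coalition-K⇔adj-L a b = ⇔.trans (coalition⇔dominates₂ K no-full-K) (⇔.trans
    (mk⇔ (λ (a≢b , dom) → a≢b , to (dominates₂-K⇔ a≢b) dom)
         (λ (a≢b , one-small) → a≢b , from (dominates₂-K⇔ a≢b) one-small))
    (⇔.sym (L-adj⇔ a b)))

  K→L : Step K L
  K→L = isSP-K , Function.id , Identity.bijective _≡_ , λ a b → ⇔.sym (coalition-K⇔adj-L a b)

  large-¬adj-L : ∀ {a b} → small a ≡ false → small b ≡ false → ¬ Adj L a b
  large-¬adj-L {a} {b} sa sb a~b with to (L-adj⇔ a b) a~b
  ... | _ , inj₁ sa′ with () ← trans (sym sa) sa′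
  ... | _ , inj₂ sb′ with () ← trans (sym sb) sb′

  small⇒full-L : ∀ {w} → small w ≡ true → Full L w
  small⇒full-L {w} sw z z≢w = from (L-adj⇔ w z) (z≢w ∘ sym , inj₁ sw)

  -- The partner of the large vertex 2 is not full, hence large, and leaves a third large vertex
  -- undominated.
  ¬isSP-L : ¬ IsSP L
  ¬isSP-L sp with sp 2F
  ... | inj₁ dom with () ← to (dominating-⁅⁆⇔full L {2F}) dom 3F (λ ())
  ... | inj₂ (_ , w , _ , c) with 2≢w , _ , ¬full-w , dom ← to (coalition-⁅⁆⇔ L {2F} {w}) c
    with z , z-large , z≢2 , z≢w ← large-avoiding 2F w
    with dom z z≢2 z≢w
  ... | inj₁ 2~z = large-¬adj-L {2F} {z} refl z-large 2~z
  ... | inj₂ w~z = large-¬adj-L {w} {z} (¬-not (¬full-w ∘ small⇒full-L)) z-large w~z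

-- Graphs of shape ℋ₁

H1Edge-sym : ∀ {x y : Fin n} {Q a b} → H1Edge x y Q a b → H1Edge x y Q b a
H1Edge-sym (inj₁ e)               = inj₂ (inj₁ e)
H1Edge-sym (inj₂ (inj₁ e))        = inj₁ e
H1Edge-sym (inj₂ (inj₂ (inj₁ e))) = inj₂ (inj₂ (inj₂ e))
H1Edge-sym (inj₂ (inj₂ (inj₂ e))) = inj₂ (inj₂ (inj₁ e))

module H1Shape (H : Graph n) {x y : Fin n} {Q : Subset n} (x≢y : x ≢ y) (x∉Q : x ∉ Q) (y∉Q : y ∉ Q)
               (shape : ∀ a b → Adj H a b ⇔ H1Edge x y Q a b) where

  Q-neighbour : ∀ {q a} → q ∈ Q → Adj H q a → a ≡ y
  Q-neighbour {q} q∈Q q~a with to (shape q _) q~a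
  ... | inj₁ (refl , _)                    = ⊥-elim (y∉Q q∈Q)
  ... | inj₂ (inj₁ (a≡y , _))              = a≡y
  ... | inj₂ (inj₂ (inj₁ (refl , _)))      = ⊥-elim (x∉Q q∈Q)
  ... | inj₂ (inj₂ (inj₂ (refl , _ , _ , q∉Q))) = ⊥-elim (q∉Q q∈Q)

  ¬y~x : ¬ Adj H y x
  ¬y~x y~x with to (shape y x) y~x
  ... | inj₁ (_ , _ , x≢x)               = x≢x refl
  ... | inj₂ (inj₁ (x≡y , _))            = x≢y x≡y
  ... | inj₂ (inj₂ (inj₁ (y≡x , _)))     = x≢y (sym y≡x)
  ... | inj₂ (inj₂ (inj₂ (_ , _ , y≢y , _))) = y≢y refl

  ∈Q⇒≢ : ∀ {q a} → q ∈ Q → a ∉ Q → q ≢ a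
  ∈Q⇒≢ q∈Q a∉Q refl = a∉Q q∈Q

  -- w has to dominate x, which is not adjacent to Q.
  Q-partner : ∀ {q w} → q ∈ Q → Dominates₂ H q w → w ∉ Q × w ≢ y
  Q-partner {q} {w} q∈Q dom with w ≟ x
  ... | yes refl = x∉Q , x≢y
  ... | no w≢x with dom x (∈Q⇒≢ q∈Q x∉Q ∘ sym) (w≢x ∘ sym)
  ...   | inj₁ q~x = ⊥-elim (x≢y (Q-neighbour q∈Q q~x))
  ...   | inj₂ w~x = (λ w∈Q → x≢y (Q-neighbour w∈Q w~x)) , λ { refl → ¬y~x w~x }

  -- q′ is adjacent only to y, which is neither q nor the partner of q.
  ¬isSP : ∀ {q q′} → q ∈ Q → q′ ∈ Q → q ≢ q′ → ¬ IsSP H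
  ¬isSP {q} {q′} q∈Q q′∈Q q≢q′ sp with sp q
  ... | inj₁ dom = x≢y (Q-neighbour q∈Q (to (dominating-⁅⁆⇔full H) dom x (∈Q⇒≢ q∈Q x∉Q ∘ sym)))
  ... | inj₂ (_ , w , _ , c) with _ , _ , _ , dom ← to (coalition-⁅⁆⇔ H) c
    with w∉Q , w≢y ← Q-partner q∈Q dom
    with dom q′ (q≢q′ ∘ sym) (∈Q⇒≢ q′∈Q w∉Q)
  ... | inj₁ q~q′ = y∉Q (subst (_∈ Q) (Q-neighbour q′∈Q (adj-sym H q~q′)) q∈Q)
  ... | inj₂ w~q′ = w≢y (Q-neighbour q′∈Q (adj-sym H w~q′))

module _ {k} (H : Graph (2 + k)) {x y : Fin (2 + k)} {Q : Subset (2 + k)}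
         (x≢y : x ≢ y) (Q-empty : Empty Q) (shape : ∀ a b → Adj H a b ⇔ H1Edge x y Q a b) where

  private
    End : Fin (2 + k) → Set
    End a = a ≡ x ⊎ a ≡ y

    end? : ∀ a → Dec (End a)
    end? a = a ≟ x ⊎-dec a ≟ y

    one-end : ∀ {a b} → H1Edge x y Q a b → (End a × ¬ End b) ⊎ (¬ End a × End b)
    one-end (inj₁ (a≡y , b≢y , b≢x))              = inj₁ (inj₂ a≡y , [ b≢x , b≢y ]′)
    one-end (inj₂ (inj₁ (b≡y , a≢y , a≢x)))       = inj₂ ([ a≢x , a≢y ]′ , inj₂ b≡y)
    one-end (inj₂ (inj₂ (inj₁ (a≡x , b≢x , b≢y , _)))) = inj₁ (inj₁ a≡x , [ b≢x , b≢y ]′)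
    one-end (inj₂ (inj₂ (inj₂ (b≡x , a≢x , a≢y , _)))) = inj₂ ([ a≢x , a≢y ]′ , inj₁ b≡x)

    ∉Q : ∀ a → a ∉ Q
    ∉Q a a∈Q = Q-empty (a , a∈Q)

    H1Edge⇔end-xor : ∀ a b → H1Edge x y Q a b ⇔ (does (end? a) xor does (end? b) ≡ true)
    H1Edge⇔end-xor a b = mk⇔ (⇒ (end? a) (end? b)) (⇐ (end? a) (end? b))
      where
      ⇒ : (a? : Dec (End a)) (b? : Dec (End b)) → H1Edge x y Q a b → does a? xor does b? ≡ true
      ⇒ a? b? edge with one-end edge
      ... | inj₁ (a-end , b-inner) rewrite dec-true a? a-end | dec-false b? b-inner = refl
      ... | inj₂ (a-inner , b-end) rewrite dec-false a? a-inner | dec-true b? b-end = refl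
      ⇐ : (a? : Dec (End a)) (b? : Dec (End b)) → does a? xor does b? ≡ true → H1Edge x y Q a b
      ⇐ (yes (inj₁ a≡x)) (no ¬b) _ = inj₂ (inj₂ (inj₁ (a≡x , ¬b ∘ inj₁ , ¬b ∘ inj₂ , ∉Q b)))
      ⇐ (yes (inj₂ a≡y)) (no ¬b) _ = inj₁ (a≡y , ¬b ∘ inj₂ , ¬b ∘ inj₁)
      ⇐ (no ¬a) (yes (inj₁ b≡x)) _ = inj₂ (inj₂ (inj₂ (b≡x , ¬a ∘ inj₁ , ¬a ∘ inj₂ , ∉Q a)))
      ⇐ (no ¬a) (yes (inj₂ b≡y)) _ = inj₂ (inj₁ (b≡y , ¬a ∘ inj₂ , ¬a ∘ inj₁))

  ≅K2,n-2 : H ≅ K2,n-2 (2 + k)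
  ≅K2,n-2 with π , x↦0 , y↦1 ← move-to-0,1 x≢y =
    mk≅ (π ⟨$⟩ʳ_) (permutation-bijective π)
    λ a b → ⇔.trans (shape a b) (⇔.trans (H1Edge⇔end-xor a b)
              (≡-⇔ (cong₂ _xor_ (sym (small a)) (sym (small b)))))
    where
    ≡-⇔ : ∀ {p q : Bool} → p ≡ q → (p ≡ true) ⇔ (q ≡ true)
    ≡-⇔ refl = ⇔.refl
    π-end : ∀ a → (π ⟨$⟩ʳ a ≡ 0F ⊎ π ⟨$⟩ʳ a ≡ 1F) ⇔ End a
    π-end a = mk⇔
      (λ { (inj₁ e) → inj₁ (permutation-injective π (trans e (sym x↦0)))
         ; (inj₂ e) → inj₂ (permutation-injective π (trans e (sym y↦1))) })
      (λ { (inj₁ refl) → inj₁ x↦0 ; (inj₂ refl) → inj₂ y↦1 })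
    -- does (i <? 2) computes to the edge test i <ᵇ 2 of K₂,ₙ₋₂.
    small : ∀ a → (toℕ (π ⟨$⟩ʳ a) <ᵇ 2) ≡ does (end? a)
    small a = does-⇔ (⇔.trans <2⇔0F⊎1F (π-end a)) (toℕ (π ⟨$⟩ʳ a) <? 2) (end? a)

K2,n-2-chains : (G : Graph n) → IsSP G → 4 ≤ n → ∀ {x y Q} → x ≢ y → Empty Q →
                (∀ a b → Adj (coalitionGraph G) a b ⇔ H1Edge x y Q a b) →
                  (Step G C4 × Step C4 K4 × Step K4 K̄4 × Ends K̄4)
                ⊎ (Step G (K2,n-2 n) × Step (K2,n-2 n) (K1+K1,n-2 n) × Ends (K1+K1,n-2 n))
K2,n-2-chains G sp (s≤s (s≤s (s≤s (s≤s (z≤n {zero}))))) x≢y Q-empty shape =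
  inj₁ (step G C4 sp (≅-trans (≅K2,n-2 (coalitionGraph G) x≢y Q-empty shape) K2,2≅C4) , C4→K4→K̄4)
K2,n-2-chains G sp (s≤s (s≤s (s≤s (s≤s (z≤n {suc k}))))) x≢y Q-empty shape =
  inj₂ (step G (K2,n-2 _) sp (≅K2,n-2 (coalitionGraph G) x≢y Q-empty shape) , K→L , ¬isSP-L)
  where open K2,n-2-large k

-- Graphs with a leaf

module Leaf (G : Graph n) (sp : IsSP G) (no-full : ∀ a → ¬ Full G a)
            {v u : Fin n} (v~u : Adj G v u) (leaf : ∀ z → Adj G v z → z ≡ u) where

  v≢u : v ≢ u
  v≢u = adj⇒≢ G v~u

  dominates₂⇒meets-uv : ∀ {a b} → Dominates₂ G a b → (a ≡ u ⊎ a ≡ v) ⊎ (b ≡ u ⊎ b ≡ v)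
  dominates₂⇒meets-uv {a} {b} dom with v ≟ a | v ≟ b
  ... | yes v≡a | _       = inj₁ (inj₂ (sym v≡a))
  ... | no _    | yes v≡b = inj₂ (inj₂ (sym v≡b))
  ... | no v≢a  | no v≢b with dom v v≢a v≢b
  ...   | inj₁ a~v = inj₁ (inj₁ (leaf a (adj-sym G a~v)))
  ...   | inj₂ b~v = inj₂ (inj₁ (leaf b (adj-sym G b~v)))

  ¬dominates₂-u-v : ¬ Dominates₂ G u v
  ¬dominates₂-u-v dom with z , z≢u , ¬u~z ← ¬full⇒non-neighbour G (no-full u)
    with dom z z≢u (λ { refl → ¬u~z (adj-sym G v~u) })
  ... | inj₁ u~z = ¬u~z u~z
  ... | inj₂ v~z = z≢u (leaf z v~z)

  -- u can replace v: v dominates only u, and u dominates v.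
  dominates₂-with-v⇒with-u : ∀ {z} → Dominates₂ G z v → Dominates₂ G u z
  dominates₂-with-v⇒with-u dom t t≢u t≢z with t ≟ v
  ... | yes refl = inj₁ (adj-sym G v~u)
  ... | no t≢v with dom t t≢z t≢v
  ...   | inj₁ z~t = inj₂ z~t
  ...   | inj₂ v~t = ⊥-elim (t≢u (leaf t v~t))

  dominates₂-u : ∀ {z} → z ≢ u → z ≢ v → Dominates₂ G u z
  dominates₂-u {z} z≢u z≢v with w , _ , dom ← to (isSP⇔partners G no-full) sp z
    with dominates₂⇒meets-uv dom
  ... | inj₁ (inj₁ z≡u) = ⊥-elim (z≢u z≡u)
  ... | inj₁ (inj₂ z≡v) = ⊥-elim (z≢v z≡v)
  ... | inj₂ (inj₁ refl) = dominates₂-sym G dom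
  ... | inj₂ (inj₂ refl) = dominates₂-with-v⇒with-u dom

  -- The set Q₁ of ℋ₁ for x₁ = v and y₁ = u.
  InQ : Pred (Fin n) 0ℓ
  InQ z = z ≢ u × z ≢ v × ¬ Dominates₂ G v z

  inQ? : Decidable InQ
  inQ? z = ¬? (z ≟ u) ×-dec ¬? (z ≟ v) ×-dec ¬? (dominates₂? G v z)

  Q : Subset n
  Q = subset inQ?

  ∈Q⇔ : ∀ {z} → z ∈ Q ⇔ InQ z
  ∈Q⇔ = ∈-subset inQ?

  u∉Q : u ∉ Q
  u∉Q u∈Q = proj₁ (to ∈Q⇔ u∈Q) refl

  v∉Q : v ∉ Q
  v∉Q v∈Q = proj₁ (proj₂ (to ∈Q⇔ v∈Q)) refl

  dominates₂-v⇒∉Q : ∀ {z} → Dominates₂ G v z → z ∉ Q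
  dominates₂-v⇒∉Q dom z∈Q = proj₂ (proj₂ (to ∈Q⇔ z∈Q)) dom

  coalition⇔H1Edge : ∀ a b → Coalition G ⁅ a ⁆ ⁅ b ⁆ ⇔ H1Edge v u Q a b
  coalition⇔H1Edge a b = ⇔.trans (coalition⇔dominates₂ G no-full) (mk⇔ ⇒ ⇐)
    where
    swap : ∀ {a b} → a ≢ b × Dominates₂ G a b → b ≢ a × Dominates₂ G b a
    swap (a≢b , dom) = a≢b ∘ sym , dominates₂-sym G dom

    from-u-or-v : ∀ {a b} → a ≡ u ⊎ a ≡ v → a ≢ b × Dominates₂ G a b → H1Edge v u Q a b
    from-u-or-v (inj₁ refl) (a≢b , dom) = inj₁ (refl , a≢b ∘ sym , λ { refl → ¬dominates₂-u-v dom })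
    from-u-or-v (inj₂ refl) (a≢b , dom) = inj₂ (inj₂ (inj₁ (refl , a≢b ∘ sym ,
      (λ { refl → ¬dominates₂-u-v (dominates₂-sym G dom) }) , dominates₂-v⇒∉Q dom)))

    ⇒ : a ≢ b × Dominates₂ G a b → H1Edge v u Q a b
    ⇒ c with dominates₂⇒meets-uv (proj₂ c)
    ... | inj₁ a-is-u-or-v = from-u-or-v a-is-u-or-v c
    ... | inj₂ b-is-u-or-v = H1Edge-sym (from-u-or-v b-is-u-or-v (swap c))

    with-u : ∀ {z} → z ≢ u → z ≢ v → u ≢ z × Dominates₂ G u z
    with-u z≢u z≢v = z≢u ∘ sym , dominates₂-u z≢u z≢v

    with-v : ∀ {z} → z ≢ v → z ≢ u → z ∉ Q → v ≢ z × Dominates₂ G v z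
    with-v z≢v z≢u z∉Q = z≢v ∘ sym ,
      decidable-stable (dominates₂? G v _) λ ¬dom → z∉Q (from ∈Q⇔ (z≢u , z≢v , ¬dom))

    ⇐ : H1Edge v u Q a b → a ≢ b × Dominates₂ G a b
    ⇐ (inj₁ (refl , b≢u , b≢v))                        = with-u b≢u b≢v
    ⇐ (inj₂ (inj₁ (refl , a≢u , a≢v)))                 = swap (with-u a≢u a≢v)
    ⇐ (inj₂ (inj₂ (inj₁ (refl , b≢v , b≢u , b∉Q))))   = with-v b≢v b≢u b∉Q
    ⇐ (inj₂ (inj₂ (inj₂ (refl , a≢v , a≢u , a∉Q))))   = swap (with-v a≢v a≢u a∉Q)

  coalitionGraph-shape : ∀ a b → Adj (coalitionGraph G) a b ⇔ H1Edge v u Q a b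
  coalitionGraph-shape a b = ⇔.trans (does≡true⇔ (coalition? G a b)) (coalition⇔H1Edge a b)

  -- A non-neighbour z of u has a neighbour t, and v, u, z, t are distinct.
  4≤n : (∀ a → 1 ≤ deg G a) → 4 ≤ n
  4≤n deg≥1 with z , z≢u , ¬u~z ← ¬full⇒non-neighbour G (no-full u)
    with t , t∈N ← 1≤∣p∣⇒nonempty (deg≥1 z)
    with z~t ← to (∈-tabulate (E G z)) t∈N
    = distinct⇒4≤n v u z t (v≢u ∘ sym) z≢v z≢u
        (λ { refl → z≢u (leaf z (adj-sym G z~t)) }) (λ { refl → ¬u~z (adj-sym G z~t) }) (adj⇒≢ G z~t ∘ sym)
    where
    z≢v : z ≢ v
    z≢v refl = ¬u~z (adj-sym G v~u)

  -- A vertex z left undominated by {v, q} is in Q: were {v, z} dominating, q would be adjacent to z.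
  another-in-Q : ∀ {q} → q ∈ Q → ∃[ z ] (z ∈ Q × q ≢ z)
  another-in-Q {q} q∈Q with q≢u , q≢v , ¬dom ← to ∈Q⇔ q∈Q
    with z , z≢v , z≢q , ¬v~z , ¬q~z ← ¬dominates₂⇒undominated G ¬dom
    = z , from ∈Q⇔ ((λ { refl → ¬v~z v~u }) , z≢v , ¬dom-v-z) , z≢q ∘ sym
    where
    ¬dom-v-z : ¬ Dominates₂ G v z
    ¬dom-v-z dom with dom q q≢v (z≢q ∘ sym)
    ... | inj₁ v~q = q≢u (leaf q v~q)
    ... | inj₂ z~q = ¬q~z (adj-sym G z~q)

  open H1Shape (coalitionGraph G) v≢u v∉Q u∉Q coalitionGraph-shape using (¬isSP)

  inH1 : 4 ≤ n → ∣ Q ∣ ≡ 0 ⊎ 2 ≤ ∣ Q ∣ → InH1 (coalitionGraph G)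
  inH1 4≤n ∣Q∣ with w , v≢w , dom ← to (isSP⇔partners G no-full) sp v =
    v , u , w , Q , v≢u , v≢w ∘ sym , (λ { refl → ¬dominates₂-u-v (dominates₂-sym G dom) }) ,
    v∉Q , u∉Q , dominates₂-v⇒∉Q dom , 4≤n , ∣Q∣ , coalitionGraph-shape

  sc-chain : 4 ≤ n →
      (Σ (Graph n) λ H → InH1 H × Step G H × Ends H)
    ⊎ (Step G C4 × Step C4 K4 × Step K4 K̄4 × Ends K̄4)
    ⊎ (Step G (K2,n-2 n) × Step (K2,n-2 n) (K1+K1,n-2 n) × Ends (K1+K1,n-2 n))
  sc-chain 4≤n with nonempty? Q
  ... | yes (q , q∈Q) with z , z∈Q , q≢z ← another-in-Q q∈Q =
    inj₁ (coalitionGraph G , inH1 4≤n (inj₂ (distinct-members⇒2≤∣p∣ q∈Q z∈Q q≢z)) ,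
          (sp , isSingletonCG-coalitionGraph G) , ¬isSP q∈Q z∈Q q≢z)
  ... | no Q-empty = inj₂ (K2,n-2-chains G sp 4≤n v≢u Q-empty coalitionGraph-shape)

theorem10 : (n : ℕ) (G : Graph n) →
    IsSP G → MinDegreeOne G → (∀ v → ¬ Full G v) →
      (Σ (Graph n) λ H → InH1 H × Step G H × Ends H)
    ⊎ (Step G C4 × Step C4 K4 × Step K4 K̄4 × Ends K̄4)
    ⊎ (Step G (K2,n-2 n) × Step (K2,n-2 n) (K1+K1,n-2 n) × Ends (K1+K1,n-2 n))
theorem10 n G sp (deg≥1 , v , deg-v≡1) no-full
  with u , u∈N , unique ← ∣p∣≡1⇒unique-member deg-v≡1 =
  sc-chain (4≤n deg≥1)
  where
  v~u : Adj G v u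
  v~u = to (∈-tabulate (E G v)) u∈N
  leaf : ∀ z → Adj G v z → z ≡ u
  leaf z v~z = unique z (from (∈-tabulate (E G v)) v~z)
  open Leaf G sp no-full v~u leaf
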